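{- Let $\mathcal C$ be a finite set and let $L_1$ and $L_2$ be two distinct linear orderings of $\mathcal C$. The vertices $p^{L_1}$ and $p^{L_2}$ of the multiple choice polytope $\mathcal P_{MC}(\mathcal C)$ are adjacent if and only if: whenever a subset $S$ with $\varnothing\neq S\subsetneq\mathcal C$ is a beginning set of both $L_1$ and $L_2$, then $L_1$ and $L_2$ coincide on $S$ or coincide on $\mathcal C\setminus S$.
   Context: Let $E=\{(i,S): i\in S\subseteq\mathcal C\}$. For a linear ordering $L$ of $\mathcal C$ (with strict part $>_L$), $p^L\in\mathbb R^E$ is defined by $p^L(i,S)=1$ if $i>_L j$ for all $j\in S\setminus\{i\}$, and $p^L(i,S)=0$ otherwise. The multiple choice polytope $\mathcal P_{MC}(\mathcal C)$ is the convex hull of all $p^L$; its vertices are exactly the points $p^L$. A beginning set of $L$ is a set of the form $L^-(i)=\{j\in\mathcal C: j\ge_L i\}$ for some $i\in\mathcal C$. Two linear orderings coincide on a subset $S$ if their restrictions to $S$ are equal. Two vertices of a polytope are adjacent if the segment joining them is a face of the polytope.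
   Formalization: Adjacency of $p^{L_1}$ and $p^{L_2}$ is expressed through a linear functional with rational coefficients, rather than real ones, whose maximisers over the vertices of $\mathcal P_{MC}(\mathcal C)$ are exactly these two vertices. -}

module Defs where

open import Data.Nat using (ℕ; zero; suc)
open import Data.Bool using (Bool; true; false; if_then_else_)
open import Data.Fin using (Fin) renaming (_<_ to _<ᶠ_; _≤_ to _≤ᶠ_)
import Data.Fin.Properties as FinP
open import Data.Fin.Subset using (Subset; _∈_; _∉_; ∁; Nonempty)
open import Data.Fin.Subset.Properties using (_∈?_)
open import Data.Fin.Permutation using (Permutation′; _⟨$⟩ʳ_)
open import Data.Vec using (Vec; []; _∷_)
open import Data.List using (List; []; _∷_; map; concatMap; foldr)
open import Data.Rational using (ℚ; 0ℚ; 1ℚ; _+_; _*_; _<_)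
open import Data.Product using (Σ; ∃; _×_; _,_)
open import Function.Bundles using (_⇔_)
open import Relation.Nullary using (¬_; Dec; yes; no; ⌊_⌋)
open import Relation.Binary.PropositionalEquality using (_≡_; _≢_)

-- The ground set 𝒞 is Fin n.
-- A linear ordering L of Fin n is encoded by a bijective rank function
-- (a permutation); i >_L j  iff  rank i > rank j.
LinOrd : ℕ → Set
LinOrd n = Permutation′ n

_>[_]_ : ∀ {n} → Fin n → LinOrd n → Fin n → Set
i >[ L ] j = (L ⟨$⟩ʳ j) <ᶠ (L ⟨$⟩ʳ i)

_≥[_]_ : ∀ {n} → Fin n → LinOrd n → Fin n → Set
i ≥[ L ] j = (L ⟨$⟩ʳ j) ≤ᶠ (L ⟨$⟩ʳ i)

IsTop : ∀ {n} → LinOrd n → Fin n → Subset n → Set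
IsTop L i S = ∀ j → j ∈ S → j ≢ i → i >[ L ] j

isTop? : ∀ {n} (L : LinOrd n) (i : Fin n) (S : Subset n) → Dec (IsTop L i S)
isTop? L i S = FinP.all? (λ j → dimp (j ∈? S) (dimp (dneg (j FinP.≟ i)) (_ FinP.<? _)))
  where
  open import Relation.Nullary.Decidable using () renaming (¬? to dneg)
  open import Relation.Nullary.Decidable using () renaming (_→-dec_ to dimp)

-- the vertex p^L ∈ ℚ^E, as a function of (i , S) (only used for i ∈ S)
p : ∀ {n} → LinOrd n → Fin n → Subset n → ℚ
p L i S = if ⌊ isTop? L i S ⌋ then 1ℚ else 0ℚ

allSubsets : (n : ℕ) → List (Subset n)
allSubsets zero = [] ∷ []
allSubsets (suc n) = concatMap (λ S → (true ∷ S) ∷ (false ∷ S) ∷ []) (allSubsets n)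

allFinL : (n : ℕ) → List (Fin n)
allFinL n = Data.List.allFin n

sumℚ : List ℚ → ℚ
sumℚ = foldr _+_ 0ℚ

-- A vector of ℚ^E is a function c on pairs (i , S); only pairs with i ∈ S
-- (i.e. elements of E) contribute to the inner product.
Vecᴱ : ℕ → Set
Vecᴱ n = Fin n → Subset n → ℚ

⟪_,_⟫ : ∀ {n} → Vecᴱ n → Vecᴱ n → ℚ
⟪_,_⟫ {n} c x = sumℚ (concatMap (λ S → map (λ i → if ⌊ i ∈? S ⌋ then c i S * x i S else 0ℚ) (allFinL n)) (allSubsets n))

_≡ᴱ_ : ∀ {n} → Vecᴱ n → Vecᴱ n → Set
x ≡ᴱ y = ∀ i S → i ∈ S → x i S ≡ y i S

-- Adjacency of vertices p^L1, p^L2 of P_MC = conv{p^L}: the segment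
-- [p^L1, p^L2] is a face, i.e. there is a linear functional c whose
-- maximum over the polytope is attained exactly on that segment:
-- c·p^L1 = c·p^L2 and c·p^L < c·p^L1 for every vertex p^L different
-- from p^L1 and p^L2.
Adjacent : ∀ {n} → LinOrd n → LinOrd n → Set
Adjacent {n} L₁ L₂ =
  Σ (Vecᴱ n) λ c →
    (⟪ c , p L₁ ⟫ ≡ ⟪ c , p L₂ ⟫) ×
    (∀ (L : LinOrd n) → ¬ (p L ≡ᴱ p L₁) → ¬ (p L ≡ᴱ p L₂) → ⟪ c , p L ⟫ < ⟪ c , p L₁ ⟫)

CoincideOn : ∀ {n} → LinOrd n → LinOrd n → Subset n → Set
CoincideOn L₁ L₂ S = ∀ i j → i ∈ S → j ∈ S → (i >[ L₁ ] j ⇔ i >[ L₂ ] j)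

IsBeginningSet : ∀ {n} → LinOrd n → Subset n → Set
IsBeginningSet {n} L S = Σ (Fin n) λ i → ∀ j → (j ∈ S ⇔ j ≥[ L ] i)

Proper : ∀ {n} → Subset n → Set
Proper S = ∃ λ j → j ∉ S

{-# OPTIONS --safe #-}

-- Write ↓ L i for the set of elements that are ≤_L i. Then p^L(i,S) = [S ⊆ ↓ L i]. Möbius
-- inversion on the Boolean lattice therefore realises any weight W(i,T) that vanishes for
-- i ∉ T as a linear functional c with c·p^L = Σᵢ W(i, ↓ L i).
--
-- Sufficiency: take W(i,T) = -1 when T is neither ↓ L₁ i nor ↓ L₂ i. Then c is maximal at
-- p^L exactly when every ↓ L i is one of the two. Under the beginning-set condition this
-- forces ↓ L i = ↓ L₁ i for all i, or ↓ L i = ↓ L₂ i for all i. At a switch between the two,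
-- the elements above the switch form a common beginning set, and L₁ and L₂ do not coincide
-- on its complement. So they coincide on the set itself, and their down-sets agree above
-- the switch.
--
-- Necessity: suppose L₁ and L₂ differ on a common beginning set S and also on ∁ S. Splicing
-- them along S gives L₃ and L₄ with p^{L₃} + p^{L₄} = p^{L₁} + p^{L₂}, and neither is L₁ or
-- L₂. No functional can then be strictly smaller at both of them.

module Submission where

open import Defs
open import Data.Nat using (ℕ)
open import Data.Fin.Subset using (Subset; ∁; Nonempty)
open import Data.Product using (_×_)
open import Data.Sum using (_⊎_)
open import Function.Bundles using (_⇔_)
open import Relation.Nullary using (¬_)

open import Level using (0ℓ)
open import Algebra.Bundles using (module CommutativeMonoid)
open import Data.Bool using (Bool; true; false; if_then_else_)
import Data.Bool.Properties as Bool
open import Data.Empty using (⊥-elim)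
open import Data.Fin as Fin using (Fin; toℕ; fromℕ<)
import Data.Fin.Properties as Fin
open import Data.Fin.Permutation using (_⟨$⟩ʳ_; _⟨$⟩ˡ_; inverseˡ; inverseʳ; permutation)
open import Data.Fin.Subset using (_∈_; _∉_; _⊆_; ⁅_⁆; _∪_)
open import Data.Fin.Subset.Properties
  using (_∈?_; _⊆?_; in⊆in-⇔; out⊆-⇔; ⊆-antisym; x∈∁p⇒x∉p; x∉p⇒x∈∁p; x∉∁p⇒x∈p;
         x∈⁅x⁆; x∈⁅y⁆⇒x≡y; x∈p∪q⁺; x∈p∪q⁻)
import Data.Integer as ℤ
open import Data.List using (List; []; _∷_; _++_; map; concatMap)
open import Data.List.Membership.Propositional using () renaming (_∈_ to _∈ₗ_)
open import Data.List.Membership.Propositional.Properties using (∈-allFin)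
open import Data.List.Properties using (map-concatMap)
open import Data.List.Relation.Unary.Any using (here; there)
open import Data.Nat as ℕ using (zero; suc; _≤_; _<_; _≤?_; s≤s)
import Data.Nat.Properties as ℕ
open import Data.Product using (_,_; proj₁; ∃)
open import Data.Rational as ℚ using (ℚ; 0ℚ; 1ℚ; _+_; _*_; -_)
import Data.Rational.Properties as ℚ
open import Data.Rational.Solver using (module +-*-Solver)
open import Data.Sum using (inj₁; inj₂; [_,_]′)
import Data.Sum as Sum
open import Data.Vec using ([]; _∷_; tabulate; here; there)
open import Data.Vec.Properties using (lookup∘tabulate; []=⇒lookup; lookup⇒[]=; ≡-dec)
open import Function using (_∘_; flip; id; case_of_)
open import Function.Bundles using (mk⇔; Equivalence)
open import Function.Construct.Composition using (_⇔-∘_)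
open import Function.Construct.Symmetry using (⇔-sym)
open import Relation.Binary.PropositionalEquality
open import Relation.Nullary using (Dec; yes; no; ⌊_⌋; ¬?; _×-dec_; _⊎-dec_; _→-dec_)
import Relation.Nullary.Decidable as Dec
open import Relation.Unary using (Pred; Decidable)

open import Algebra.Properties.CommutativeSemigroup
  (CommutativeMonoid.commutativeSemigroup ℚ.+-0-commutativeMonoid) using (interchange)

private
  variable
    A B P Q : Set
    n : ℕ

∑ : List A → (A → ℚ) → ℚ
∑ xs f = sumℚ (map f xs)

syntax ∑ xs (λ x → e) = ∑[ x ← xs ] e

∑-cong : (xs : List A) {f g : A → ℚ} → (∀ x → f x ≡ g x) → ∑ xs f ≡ ∑ xs g
∑-cong []       f≗g = refl
∑-cong (x ∷ xs) f≗g = cong₂ _+_ (f≗g x) (∑-cong xs f≗g)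

∑-zero : (xs : List A) {f : A → ℚ} → (∀ x → f x ≡ 0ℚ) → ∑ xs f ≡ 0ℚ
∑-zero []       f≗0 = refl
∑-zero (x ∷ xs) f≗0 = trans (cong₂ _+_ (f≗0 x) (∑-zero xs f≗0)) (ℚ.+-identityˡ 0ℚ)

∑-+ : (xs : List A) (f g : A → ℚ) → ∑[ x ← xs ] (f x + g x) ≡ ∑ xs f + ∑ xs g
∑-+ []       f g = refl
∑-+ (x ∷ xs) f g = trans (cong (f x + g x +_) (∑-+ xs f g)) (interchange (f x) (g x) _ _)

∑-*ˡ : (xs : List A) (a : ℚ) (f : A → ℚ) → ∑[ x ← xs ] (a * f x) ≡ a * ∑ xs f
∑-*ˡ []       a f = sym (ℚ.*-zeroʳ a)
∑-*ˡ (x ∷ xs) a f = trans (cong (a * f x +_) (∑-*ˡ xs a f)) (sym (ℚ.*-distribˡ-+ a (f x) _))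

∑-*ʳ : (xs : List A) (a : ℚ) (f : A → ℚ) → ∑[ x ← xs ] (f x * a) ≡ ∑ xs f * a
∑-*ʳ xs a f = trans (∑-cong xs (λ x → ℚ.*-comm (f x) a)) (trans (∑-*ˡ xs a f) (ℚ.*-comm a _))

∑-swap : (xs : List A) (ys : List B) (f : A → B → ℚ) →
         ∑[ x ← xs ] ∑[ y ← ys ] f x y ≡ ∑[ y ← ys ] ∑[ x ← xs ] f x y
∑-swap []       ys f = sym (∑-zero ys (λ _ → refl))
∑-swap (x ∷ xs) ys f =
  trans (cong (∑ ys (f x) +_) (∑-swap xs ys f)) (sym (∑-+ ys (f x) (λ y → ∑[ x′ ← xs ] f x′ y)))

sumℚ-++ : (xs ys : List ℚ) → sumℚ (xs ++ ys) ≡ sumℚ xs + sumℚ ys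
sumℚ-++ []       ys = sym (ℚ.+-identityˡ _)
sumℚ-++ (x ∷ xs) ys = trans (cong (x +_) (sumℚ-++ xs ys)) (sym (ℚ.+-assoc x _ _))

sumℚ-concatMap : (xs : List A) (g : A → List ℚ) → sumℚ (concatMap g xs) ≡ ∑[ x ← xs ] sumℚ (g x)
sumℚ-concatMap []       g = refl
sumℚ-concatMap (x ∷ xs) g = trans (sumℚ-++ (g x) _) (cong (sumℚ (g x) +_) (sumℚ-concatMap xs g))

∑-concatMap : (xs : List A) (g : A → List B) (f : B → ℚ) →
              ∑ (concatMap g xs) f ≡ ∑[ x ← xs ] ∑ (g x) f
∑-concatMap xs g f = trans (cong sumℚ (map-concatMap f g xs)) (sumℚ-concatMap xs (map f ∘ g))

∑-nonpositive : (xs : List A) (f : A → ℚ) → (∀ x → f x ℚ.≤ 0ℚ) → ∑ xs f ℚ.≤ 0ℚ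
∑-nonpositive []       f f≤0 = ℚ.≤-refl
∑-nonpositive (x ∷ xs) f f≤0 = ℚ.+-mono-≤ (f≤0 x) (∑-nonpositive xs f f≤0)

∑-negative : (xs : List A) (f : A → ℚ) → (∀ x → f x ℚ.≤ 0ℚ) →
             ∀ {y} → y ∈ₗ xs → f y ℚ.< 0ℚ → ∑ xs f ℚ.< 0ℚ
∑-negative (x ∷ xs) f f≤0 (here refl)  fy<0 = ℚ.+-mono-<-≤ fy<0 (∑-nonpositive xs f f≤0)
∑-negative (x ∷ xs) f f≤0 (there y∈xs) fy<0 = ℚ.+-mono-≤-< (f≤0 x) (∑-negative xs f f≤0 y∈xs fy<0)

-- Möbius inversion on the Boolean lattice

𝟙 : Dec P → ℚ
𝟙 P? = if ⌊ P? ⌋ then 1ℚ else 0ℚ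

𝟙-cong : P ⇔ Q → (P? : Dec P) (Q? : Dec Q) → 𝟙 P? ≡ 𝟙 Q?
𝟙-cong P⇔Q (yes p) (yes q) = refl
𝟙-cong P⇔Q (yes p) (no ¬q) = ⊥-elim (¬q (Equivalence.to P⇔Q p))
𝟙-cong P⇔Q (no ¬p) (yes q) = ⊥-elim (¬p (Equivalence.from P⇔Q q))
𝟙-cong P⇔Q (no ¬p) (no ¬q) = refl

𝟙-yes : (P? : Dec P) → P → 𝟙 P? ≡ 1ℚ
𝟙-yes (yes _) _ = refl
𝟙-yes (no ¬p) p = ⊥-elim (¬p p)

𝟙-no : (P? : Dec P) → ¬ P → 𝟙 P? ≡ 0ℚ
𝟙-no (yes p) ¬p = ⊥-elim (¬p p)
𝟙-no (no _)  _  = refl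

𝟙≡1⇒ : (P? : Dec P) → 𝟙 P? ≡ 1ℚ → P
𝟙≡1⇒ (yes p) _  = p
𝟙≡1⇒ (no _)  ()

∏ : (Bool → Bool → ℚ) → Subset n → Subset n → ℚ
∏ f []      []      = 1ℚ
∏ f (s ∷ S) (t ∷ T) = f s t * ∏ f S T

-- The zeta, Möbius and delta functions of the two-element chain false < true; their
-- coordinatewise products are those of the Boolean lattice Subset n.
ζ₂ μ₂ δ₂ : Bool → Bool → ℚ
ζ₂ true  false = 0ℚ
ζ₂ _     _     = 1ℚ
μ₂ true  true  = 1ℚ
μ₂ true  false = 0ℚ
μ₂ false true  = - 1ℚ
μ₂ false false = 1ℚ
δ₂ true  true  = 1ℚ
δ₂ false false = 1ℚ
δ₂ _     _     = 0ℚ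

μ₂⋆ζ₂≡δ₂ : ∀ t d → μ₂ t true * ζ₂ true d + μ₂ t false * ζ₂ false d ≡ δ₂ t d
μ₂⋆ζ₂≡δ₂ true  true  = refl
μ₂⋆ζ₂≡δ₂ true  false = refl
μ₂⋆ζ₂≡δ₂ false true  = refl
μ₂⋆ζ₂≡δ₂ false false = refl

∏ζ₂≡𝟙⊆ : (S D : Subset n) → ∏ ζ₂ S D ≡ 𝟙 (S ⊆? D)
∏ζ₂≡𝟙⊆ []          []          = refl
∏ζ₂≡𝟙⊆ (true ∷ S)  (true ∷ D)  =
  trans (ℚ.*-identityˡ _) (trans (∏ζ₂≡𝟙⊆ S D) (𝟙-cong in⊆in-⇔ (S ⊆? D) _))
∏ζ₂≡𝟙⊆ (true ∷ S)  (false ∷ D) = ℚ.*-zeroˡ (∏ ζ₂ S D)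
∏ζ₂≡𝟙⊆ (false ∷ S) (d ∷ D)     =
  trans (ℚ.*-identityˡ _) (trans (∏ζ₂≡𝟙⊆ S D) (𝟙-cong out⊆-⇔ (S ⊆? D) _))

∏μ₂-vanishes : ∀ {i} {T S : Subset n} → i ∈ T → i ∉ S → ∏ μ₂ T S ≡ 0ℚ
∏μ₂-vanishes {T = true ∷ T} {true ∷ S}  here        i∉S = ⊥-elim (i∉S here)
∏μ₂-vanishes {T = true ∷ T} {false ∷ S} here        _   = ℚ.*-zeroˡ (∏ μ₂ T S)
∏μ₂-vanishes {T = t ∷ T}    {s ∷ S}     (there i∈T) i∉S =
  trans (cong (μ₂ t s *_) (∏μ₂-vanishes i∈T (i∉S ∘ there))) (ℚ.*-zeroʳ (μ₂ t s))

∑-allSubsets-suc : (f : Subset (suc n) → ℚ) →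
                   ∑ (allSubsets (suc n)) f ≡ ∑[ S ← allSubsets n ] (f (true ∷ S) + f (false ∷ S))
∑-allSubsets-suc {n} f = trans (∑-concatMap (allSubsets n) _ f)
  (∑-cong (allSubsets n) (λ S → cong (f (true ∷ S) +_) (ℚ.+-identityʳ _)))

∏-convolution : (f g h : Bool → Bool → ℚ) →
                (∀ t d → f t true * g true d + f t false * g false d ≡ h t d) →
                (T D : Subset n) → ∑[ S ← allSubsets n ] (∏ f T S * ∏ g S D) ≡ ∏ h T D
∏-convolution f g h f⋆g≡h []      []      = refl
∏-convolution {suc n} f g h f⋆g≡h (t ∷ T) (d ∷ D) = begin
  ∑[ S ← allSubsets (suc n) ] (∏ f (t ∷ T) S * ∏ g S (d ∷ D))
    ≡⟨ ∑-allSubsets-suc (λ S → ∏ f (t ∷ T) S * ∏ g S (d ∷ D)) ⟩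
  ∑[ S ← allSubsets n ] ((f t true * ∏ f T S) * (g true d * ∏ g S D)
                         + (f t false * ∏ f T S) * (g false d * ∏ g S D))
    ≡⟨ ∑-cong (allSubsets n) (λ S →
         factor (f t true) (g true d) (f t false) (g false d) (∏ f T S) (∏ g S D)) ⟩
  ∑[ S ← allSubsets n ] (f⋆g * (∏ f T S * ∏ g S D))
    ≡⟨ ∑-*ˡ (allSubsets n) f⋆g (λ S → ∏ f T S * ∏ g S D) ⟩
  f⋆g * ∑[ S ← allSubsets n ] (∏ f T S * ∏ g S D)
    ≡⟨ cong₂ _*_ (f⋆g≡h t d) (∏-convolution f g h f⋆g≡h T D) ⟩
  h t d * ∏ h T D ∎
  where
  open ≡-Reasoning
  open +-*-Solver
  f⋆g : ℚ
  f⋆g = f t true * g true d + f t false * g false d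
  factor : ∀ a b c d x y → (a * x) * (b * y) + (c * x) * (d * y) ≡ (a * b + c * d) * (x * y)
  factor = solve 6 (λ a b c d x y → (a :* x) :* (b :* y) :+ (c :* x) :* (d :* y)
                                    := (a :* b :+ c :* d) :* (x :* y)) refl

δ₂-sift : ∀ d (g : Bool → ℚ) x → g true * (δ₂ true d * x) + g false * (δ₂ false d * x) ≡ g d * x
δ₂-sift true  g x = solve 3 (λ a b x → a :* (con 1ℚ :* x) :+ b :* (con 0ℚ :* x) := a :* x) refl
                            (g true) (g false) x
  where open +-*-Solver
δ₂-sift false g x = solve 3 (λ a b x → a :* (con 0ℚ :* x) :+ b :* (con 1ℚ :* x) := b :* x) refl
                            (g true) (g false) x
  where open +-*-Solver

∑-∏δ₂ : (F : Subset n → ℚ) (D : Subset n) → ∑[ T ← allSubsets n ] (F T * ∏ δ₂ T D) ≡ F D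
∑-∏δ₂ {zero}  F []      = trans (ℚ.+-identityʳ _) (ℚ.*-identityʳ (F []))
∑-∏δ₂ {suc n} F (d ∷ D) = begin
  ∑[ T ← allSubsets (suc n) ] (F T * ∏ δ₂ T (d ∷ D))
    ≡⟨ ∑-allSubsets-suc (λ T → F T * ∏ δ₂ T (d ∷ D)) ⟩
  ∑[ T ← allSubsets n ] (F (true ∷ T) * (δ₂ true d * ∏ δ₂ T D) + F (false ∷ T) * (δ₂ false d * ∏ δ₂ T D))
    ≡⟨ ∑-cong (allSubsets n) (λ T → δ₂-sift d (λ b → F (b ∷ T)) (∏ δ₂ T D)) ⟩
  ∑[ T ← allSubsets n ] (F (d ∷ T) * ∏ δ₂ T D)
    ≡⟨ ∑-∏δ₂ (λ T → F (d ∷ T)) D ⟩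
  F (d ∷ D) ∎
  where open ≡-Reasoning

möbius-inversion : (F : Subset n → ℚ) (D : Subset n) →
                   ∑[ S ← allSubsets n ] (∑[ T ← allSubsets n ] (F T * ∏ μ₂ T S) * ∏ ζ₂ S D) ≡ F D
möbius-inversion {n} F D = begin
  ∑[ S ← 𝒮 ] (∑[ T ← 𝒮 ] (F T * ∏ μ₂ T S) * ∏ ζ₂ S D)
    ≡⟨ ∑-cong 𝒮 (λ S → sym (∑-*ʳ 𝒮 (∏ ζ₂ S D) (λ T → F T * ∏ μ₂ T S))) ⟩
  ∑[ S ← 𝒮 ] ∑[ T ← 𝒮 ] (F T * ∏ μ₂ T S * ∏ ζ₂ S D)
    ≡⟨ ∑-swap 𝒮 𝒮 _ ⟩
  ∑[ T ← 𝒮 ] ∑[ S ← 𝒮 ] (F T * ∏ μ₂ T S * ∏ ζ₂ S D)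
    ≡⟨ ∑-cong 𝒮 (λ T → trans (∑-cong 𝒮 (λ S → ℚ.*-assoc (F T) _ _)) (∑-*ˡ 𝒮 (F T) _)) ⟩
  ∑[ T ← 𝒮 ] (F T * ∑[ S ← 𝒮 ] (∏ μ₂ T S * ∏ ζ₂ S D))
    ≡⟨ ∑-cong 𝒮 (λ T → cong (F T *_) (∏-convolution μ₂ ζ₂ δ₂ μ₂⋆ζ₂≡δ₂ T D)) ⟩
  ∑[ T ← 𝒮 ] (F T * ∏ δ₂ T D)
    ≡⟨ ∑-∏δ₂ F D ⟩
  F D ∎
  where
  open ≡-Reasoning
  𝒮 : List (Subset n)
  𝒮 = allSubsets n

-- Ranks, down-sets and beginning sets

rank : LinOrd n → Fin n → ℕ
rank L x = toℕ (L ⟨$⟩ʳ x)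

rank-injective : (L : LinOrd n) {x y : Fin n} → rank L x ≡ rank L y → x ≡ y
rank-injective L eq =
  trans (sym (inverseˡ L)) (trans (cong (L ⟨$⟩ˡ_) (Fin.toℕ-injective eq)) (inverseˡ L))

rank<n : (L : LinOrd n) (x : Fin n) → rank L x < n
rank<n L x = Fin.toℕ<n (L ⟨$⟩ʳ x)

unrank : LinOrd n → ∀ {k} → k < n → Fin n
unrank L k<n = L ⟨$⟩ˡ fromℕ< k<n

rank-unrank : (L : LinOrd n) {k : ℕ} (k<n : k < n) → rank L (unrank L k<n) ≡ k
rank-unrank L k<n = trans (cong toℕ (inverseʳ L)) (Fin.toℕ-fromℕ< k<n)

successor : (L : LinOrd n) {v x : Fin n} → rank L v < rank L x → ∃ λ w → rank L w ≡ suc (rank L v)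
successor {n} L {v} {x} v<x = unrank L k<n , rank-unrank L k<n
  where
  k<n : suc (rank L v) < n
  k<n = ℕ.≤-<-trans v<x (rank<n L x)

≤∧≢⇒<-rank : (L : LinOrd n) {x y : Fin n} → rank L x ≤ rank L y → x ≢ y → rank L x < rank L y
≤∧≢⇒<-rank L x≤y x≢y = ℕ.≤∧≢⇒< x≤y (x≢y ∘ rank-injective L)

select : {P : Pred (Fin n) 0ℓ} → Decidable P → Subset n
select P? = tabulate (λ x → ⌊ P? x ⌋)

∈-select : {P : Pred (Fin n) 0ℓ} (P? : Decidable P) {x : Fin n} → x ∈ select P? ⇔ P x
∈-select P? {x} = mk⇔
  (λ x∈ → Dec.toWitness (Equivalence.from Bool.T-≡ (trans (sym (lookup∘tabulate _ x)) ([]=⇒lookup x∈))))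
  (λ Px → lookup⇒[]= x _ (trans (lookup∘tabulate _ x) (Equivalence.to Bool.T-≡ (Dec.fromWitness Px))))

subset-≡ : {S T : Subset n} → (∀ {x} → x ∈ S ⇔ x ∈ T) → S ≡ T
subset-≡ S⇔T = ⊆-antisym (Equivalence.to S⇔T) (Equivalence.from S⇔T)

_≟ₛ_ : (S T : Subset n) → Dec (S ≡ T)
_≟ₛ_ = ≡-dec Bool._≟_

↓ ↑ : LinOrd n → Fin n → Subset n
↓ L i = select (λ j → rank L j ≤? rank L i)
↑ L i = select (λ j → rank L i ≤? rank L j)

∈↓ : (L : LinOrd n) {i x : Fin n} → x ∈ ↓ L i ⇔ rank L x ≤ rank L i
∈↓ L {i} = ∈-select (λ j → rank L j ≤? rank L i)

∈↑ : (L : LinOrd n) {i x : Fin n} → x ∈ ↑ L i ⇔ rank L i ≤ rank L x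
∈↑ L {i} = ∈-select (λ j → rank L i ≤? rank L j)

↑-isBeginningSet : (L : LinOrd n) (i : Fin n) → IsBeginningSet L (↑ L i)
↑-isBeginningSet L i = i , λ j → ∈↑ L

IsTop⇔⊆↓ : (L : LinOrd n) {i : Fin n} {S : Subset n} → IsTop L i S ⇔ S ⊆ ↓ L i
IsTop⇔⊆↓ L {i} = mk⇔ top⇒⊆ ⊆⇒top
  where
  top⇒⊆ : ∀ {S} → IsTop L i S → S ⊆ ↓ L i
  top⇒⊆ top {j} j∈S with j Fin.≟ i
  ... | yes refl = Equivalence.from (∈↓ L) ℕ.≤-refl
  ... | no j≢i   = Equivalence.from (∈↓ L) (ℕ.<⇒≤ (top j j∈S j≢i))
  ⊆⇒top : ∀ {S} → S ⊆ ↓ L i → IsTop L i S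
  ⊆⇒top S⊆↓i j j∈S j≢i = ≤∧≢⇒<-rank L (Equivalence.to (∈↓ L) (S⊆↓i j∈S)) j≢i

p≡∏ζ₂↓ : (L : LinOrd n) (i : Fin n) (S : Subset n) → p L i S ≡ ∏ ζ₂ S (↓ L i)
p≡∏ζ₂↓ L i S = trans (𝟙-cong (IsTop⇔⊆↓ L) (isTop? L i S) (S ⊆? ↓ L i)) (sym (∏ζ₂≡𝟙⊆ S (↓ L i)))

↓-≡⇒p-≡ᴱ : (L L′ : LinOrd n) → (∀ i → ↓ L i ≡ ↓ L′ i) → p L ≡ᴱ p L′
↓-≡⇒p-≡ᴱ L L′ eq i S _ = trans (p≡∏ζ₂↓ L i S) (trans (cong (∏ ζ₂ S) (eq i)) (sym (p≡∏ζ₂↓ L′ i S)))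

↓-≡⇔ : (L L′ : LinOrd n) {i i′ : Fin n} →
       ↓ L i ≡ ↓ L′ i′ ⇔ (∀ x → rank L x ≤ rank L i ⇔ rank L′ x ≤ rank L′ i′)
↓-≡⇔ L L′ = mk⇔ (λ eq x → ∈↓ L′ ⇔-∘ (mk⇔ (subst (x ∈_) eq) (subst (x ∈_) (sym eq)) ⇔-∘ ⇔-sym (∈↓ L)))
                (λ ≤⇔ → subset-≡ (⇔-sym (∈↓ L′) ⇔-∘ (≤⇔ _ ⇔-∘ ∈↓ L)))

↓-≡⇒↑-≡ : (L L′ : LinOrd n) {i : Fin n} → ↓ L i ≡ ↓ L′ i → ↑ L i ≡ ↑ L′ i
↓-≡⇒↑-≡ {n} L L′ {i} eq =
  subset-≡ (⇔-sym (∈↑ L′) ⇔-∘ (mk⇔ (above L L′ eq) (above L′ L (sym eq)) ⇔-∘ ∈↑ L))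
  where
  above : (M M′ : LinOrd n) → ↓ M i ≡ ↓ M′ i → ∀ {j} → rank M i ≤ rank M j → rank M′ i ≤ rank M′ j
  above M M′ ↓M≡↓M′ {j} i≤j = ℕ.≮⇒≥ λ j<′i →
    let j≤i = Equivalence.from (Equivalence.to (↓-≡⇔ M M′) ↓M≡↓M′ j) (ℕ.<⇒≤ j<′i)
    in ℕ.<-irrefl (cong (rank M′) (rank-injective M (ℕ.≤-antisym j≤i i≤j))) j<′i

↑-successor≡∁↓ : (L : LinOrd n) {u v : Fin n} → rank L u ≡ suc (rank L v) → ↑ L u ≡ ∁ (↓ L v)
↑-successor≡∁↓ L u=v+1 = subset-≡ (mk⇔
  (λ x∈↑ → x∉p⇒x∈∁p (ℕ.<⇒≱ (subst (_≤ _) u=v+1 (Equivalence.to (∈↑ L) x∈↑)) ∘ Equivalence.to (∈↓ L)))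
  (λ x∈∁↓ → Equivalence.from (∈↑ L)
              (subst (_≤ _) (sym u=v+1) (ℕ.≰⇒> (x∈∁p⇒x∉p x∈∁↓ ∘ Equivalence.from (∈↓ L))))))

beginning-set-above : (L : LinOrd n) {S : Subset n} → IsBeginningSet L S →
                      ∀ {t x} → t ∈ S → x ∉ S → rank L x < rank L t
beginning-set-above L (i , S⇔) {t} {x} t∈S x∉S =
  ℕ.<-≤-trans (ℕ.≰⇒> (x∉S ∘ Equivalence.from (S⇔ x))) (Equivalence.to (S⇔ t) t∈S)

CoincideOn-sym : (L₁ L₂ : LinOrd n) {S : Subset n} → CoincideOn L₁ L₂ S → CoincideOn L₂ L₁ S
CoincideOn-sym L₁ L₂ co i j i∈S j∈S = ⇔-sym (co i j i∈S j∈S)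

CoincideOn⇒↓-≡ : (L₁ L₂ : LinOrd n) {S : Subset n} {t : Fin n} → CoincideOn L₁ L₂ S → t ∈ S →
                 (∀ x → x ∉ S → rank L₁ x ≤ rank L₁ t ⇔ rank L₂ x ≤ rank L₂ t) → ↓ L₁ t ≡ ↓ L₂ t
CoincideOn⇒↓-≡ L₁ L₂ {S} {t} co t∈S outside = Equivalence.from (↓-≡⇔ L₁ L₂) compare
  where
  compare : ∀ x → rank L₁ x ≤ rank L₁ t ⇔ rank L₂ x ≤ rank L₂ t
  compare x with x ∈? S | x Fin.≟ t
  ... | no x∉S  | _        = outside x x∉S
  ... | yes _   | yes refl = mk⇔ (λ _ → ℕ.≤-refl) (λ _ → ℕ.≤-refl)
  ... | yes x∈S | no x≢t   = mk⇔ (ℕ.<⇒≤ ∘ Equivalence.to (co t x t∈S x∈S) ∘ flip (≤∧≢⇒<-rank L₁) x≢t)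
                                 (ℕ.<⇒≤ ∘ Equivalence.from (co t x t∈S x∈S) ∘ flip (≤∧≢⇒<-rank L₂) x≢t)

module _ (L₁ L₂ : LinOrd n) {S : Subset n} (S-L₁ : IsBeginningSet L₁ S) (S-L₂ : IsBeginningSet L₂ S) where

  ↓-≡-inside : CoincideOn L₁ L₂ S → ∀ {t} → t ∈ S → ↓ L₁ t ≡ ↓ L₂ t
  ↓-≡-inside co t∈S = CoincideOn⇒↓-≡ L₁ L₂ co t∈S λ x x∉S →
    mk⇔ (λ _ → ℕ.<⇒≤ (beginning-set-above L₂ S-L₂ t∈S x∉S))
        (λ _ → ℕ.<⇒≤ (beginning-set-above L₁ S-L₁ t∈S x∉S))

  ↓-≡-outside : CoincideOn L₁ L₂ (∁ S) → ∀ {t} → t ∉ S → ↓ L₁ t ≡ ↓ L₂ t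
  ↓-≡-outside co t∉S = CoincideOn⇒↓-≡ L₁ L₂ co (x∉p⇒x∈∁p t∉S) λ x x∉∁S →
    mk⇔ (⊥-elim ∘ ℕ.<⇒≱ (beginning-set-above L₁ S-L₁ (x∉∁p⇒x∈p x∉∁S) t∉S))
        (⊥-elim ∘ ℕ.<⇒≱ (beginning-set-above L₂ S-L₂ (x∉∁p⇒x∈p x∉∁S) t∉S))

-- The linear functional attached to a weight

⟪⟫-≡-∑∑ : (c x : Vecᴱ n) →
  ⟪ c , x ⟫ ≡ ∑[ S ← allSubsets n ] ∑[ i ← allFinL n ] (if ⌊ i ∈? S ⌋ then c i S * x i S else 0ℚ)
⟪⟫-≡-∑∑ {n} c x = sumℚ-concatMap (allSubsets n) _

⟪⟫-+ : (c x y : Vecᴱ n) → ⟪ c , x ⟫ + ⟪ c , y ⟫ ≡ ⟪ c , (λ i S → x i S + y i S) ⟫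
⟪⟫-+ {n} c x y = begin
  ⟪ c , x ⟫ + ⟪ c , y ⟫
    ≡⟨ cong₂ _+_ (⟪⟫-≡-∑∑ c x) (⟪⟫-≡-∑∑ c y) ⟩
  ∑[ S ← 𝒮 ] ∑[ i ← ℐ ] term x S i + ∑[ S ← 𝒮 ] ∑[ i ← ℐ ] term y S i
    ≡⟨ sym (∑-+ 𝒮 _ _) ⟩
  ∑[ S ← 𝒮 ] (∑[ i ← ℐ ] term x S i + ∑[ i ← ℐ ] term y S i)
    ≡⟨ ∑-cong 𝒮 (λ S → sym (∑-+ ℐ _ _)) ⟩
  ∑[ S ← 𝒮 ] ∑[ i ← ℐ ] (term x S i + term y S i)
    ≡⟨ ∑-cong 𝒮 (λ S → ∑-cong ℐ (term-+ S)) ⟩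
  ∑[ S ← 𝒮 ] ∑[ i ← ℐ ] term (λ i S → x i S + y i S) S i
    ≡⟨ sym (⟪⟫-≡-∑∑ c _) ⟩
  ⟪ c , (λ i S → x i S + y i S) ⟫ ∎
  where
  open ≡-Reasoning
  𝒮 : List (Subset n)
  𝒮 = allSubsets n
  ℐ : List (Fin n)
  ℐ = allFinL n
  term : Vecᴱ n → Subset n → Fin n → ℚ
  term z S i = if ⌊ i ∈? S ⌋ then c i S * z i S else 0ℚ
  term-+ : ∀ S i → term x S i + term y S i ≡ term (λ i S → x i S + y i S) S i
  term-+ S i with ⌊ i ∈? S ⌋
  ... | true  = sym (ℚ.*-distribˡ-+ (c i S) (x i S) (y i S))
  ... | false = ℚ.+-identityˡ 0ℚ

⟪⟫-cong : (c : Vecᴱ n) {x y : Vecᴱ n} → x ≡ᴱ y → ⟪ c , x ⟫ ≡ ⟪ c , y ⟫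
⟪⟫-cong {n} c {x} {y} x≡y = trans (⟪⟫-≡-∑∑ c x)
  (trans (∑-cong (allSubsets n) λ S → ∑-cong (allFinL n) (term-cong S)) (sym (⟪⟫-≡-∑∑ c y)))
  where
  term-cong : ∀ S i → (if ⌊ i ∈? S ⌋ then c i S * x i S else 0ℚ) ≡ (if ⌊ i ∈? S ⌋ then c i S * y i S else 0ℚ)
  term-cong S i with i ∈? S
  ... | yes i∈S = cong (c i S *_) (x≡y i S i∈S)
  ... | no  _   = refl

functional : (Fin n → Subset n → ℚ) → Vecᴱ n
functional {n} W i S = ∑[ T ← allSubsets n ] (W i T * ∏ μ₂ T S)

⟪functional,p⟫ : (W : Fin n → Subset n → ℚ) → (∀ i T → i ∉ T → W i T ≡ 0ℚ) →
                 (L : LinOrd n) → ⟪ functional W , p L ⟫ ≡ ∑[ i ← allFinL n ] W i (↓ L i)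
⟪functional,p⟫ {n} W W-vanishes L = begin
  ⟪ functional W , p L ⟫
    ≡⟨ ⟪⟫-≡-∑∑ (functional W) (p L) ⟩
  ∑[ S ← 𝒮 ] ∑[ i ← ℐ ] (if ⌊ i ∈? S ⌋ then functional W i S * p L i S else 0ℚ)
    ≡⟨ ∑-cong 𝒮 (λ S → ∑-cong ℐ (summand S)) ⟩
  ∑[ S ← 𝒮 ] ∑[ i ← ℐ ] (functional W i S * ∏ ζ₂ S (↓ L i))
    ≡⟨ ∑-swap 𝒮 ℐ _ ⟩
  ∑[ i ← ℐ ] ∑[ S ← 𝒮 ] (functional W i S * ∏ ζ₂ S (↓ L i))
    ≡⟨ ∑-cong ℐ (λ i → möbius-inversion (W i) (↓ L i)) ⟩
  ∑[ i ← ℐ ] W i (↓ L i) ∎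
  where
  open ≡-Reasoning
  𝒮 : List (Subset n)
  𝒮 = allSubsets n
  ℐ : List (Fin n)
  ℐ = allFinL n
  functional-vanishes : ∀ {i S} → i ∉ S → functional W i S ≡ 0ℚ
  functional-vanishes {i} {S} i∉S = ∑-zero 𝒮 λ T → case i ∈? T of λ where
    (yes i∈T) → trans (cong (W i T *_) (∏μ₂-vanishes i∈T i∉S)) (ℚ.*-zeroʳ (W i T))
    (no  i∉T) → trans (cong (_* ∏ μ₂ T S) (W-vanishes i T i∉T)) (ℚ.*-zeroˡ (∏ μ₂ T S))
  summand : ∀ S i → (if ⌊ i ∈? S ⌋ then functional W i S * p L i S else 0ℚ)
                    ≡ functional W i S * ∏ ζ₂ S (↓ L i)
  summand S i with i ∈? S
  ... | yes _   = cong (functional W i S *_) (p≡∏ζ₂↓ L i S)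
  ... | no  i∉S =
    sym (trans (cong (_* ∏ ζ₂ S (↓ L i)) (functional-vanishes i∉S)) (ℚ.*-zeroˡ (∏ ζ₂ S (↓ L i))))

-- Sufficiency of the beginning-set condition

CoincideAtCommonBeginningSets : LinOrd n → LinOrd n → Set
CoincideAtCommonBeginningSets {n} L₁ L₂ =
  ∀ (S : Subset n) → Nonempty S → Proper S → IsBeginningSet L₁ S → IsBeginningSet L₂ S →
  CoincideOn L₁ L₂ S ⊎ CoincideOn L₁ L₂ (∁ S)

CoincideAtCommonBeginningSets-sym : (L₁ L₂ : LinOrd n) →
  CoincideAtCommonBeginningSets L₁ L₂ → CoincideAtCommonBeginningSets L₂ L₁
CoincideAtCommonBeginningSets-sym L₁ L₂ cond S ne pr S-L₂ S-L₁ =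
  Sum.map (CoincideOn-sym L₁ L₂) (CoincideOn-sym L₁ L₂) (cond S ne pr S-L₁ S-L₂)

-- ↑ L u is a common beginning set of La and Lb. For La this is because ↓ L u = ↓ La u.
-- For Lb it is because the complement is ↓ L v = ↓ Lb v. La and Lb cannot coincide on
-- that complement, since that would give ↓ La v = ↓ Lb v.
↓-≡-above-switch : (L La Lb : LinOrd n) → CoincideAtCommonBeginningSets La Lb →
  ∀ {u v} → rank L u ≡ suc (rank L v) → ↓ L u ≡ ↓ La u → ↓ L v ≡ ↓ Lb v → ↓ L v ≢ ↓ La v →
  ∀ {t} → t ∈ ↑ L u → ↓ La t ≡ ↓ Lb t
↓-≡-above-switch L La Lb cond {u} {v} u=v+1 u-La v-Lb v-¬La t∈S =
  [ (λ co → ↓-≡-inside La Lb S-La S-Lb co t∈S)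
  , (λ co → ⊥-elim (v-¬La (trans v-Lb (sym (↓-≡-outside La Lb S-La S-Lb co v∉S)))))
  ]′ (cond (↑ L u) (u , u∈S) (v , v∉S) S-La S-Lb)
  where
  u∈S : u ∈ ↑ L u
  u∈S = Equivalence.from (∈↑ L) ℕ.≤-refl
  v∉S : v ∉ ↑ L u
  v∉S v∈S = ℕ.1+n≰n (subst (_≤ rank L v) u=v+1 (Equivalence.to (∈↑ L) v∈S))
  S-La : IsBeginningSet La (↑ L u)
  S-La = subst (IsBeginningSet La) (sym (↓-≡⇒↑-≡ L La u-La)) (↑-isBeginningSet La u)
  v<u-in-Lb : rank Lb v < rank Lb u
  v<u-in-Lb = ℕ.≰⇒> λ u≤v →
    ℕ.1+n≰n (subst (_≤ rank L v) u=v+1 (Equivalence.from (Equivalence.to (↓-≡⇔ L Lb) v-Lb u) u≤v))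
  S-Lb : IsBeginningSet Lb (↑ L u)
  S-Lb with successor Lb v<u-in-Lb
  ... | w , w=v+1 = subst (IsBeginningSet Lb)
    (trans (↑-successor≡∁↓ Lb w=v+1) (trans (cong ∁ (sym v-Lb)) (sym (↑-successor≡∁↓ L u=v+1))))
    (↑-isBeginningSet Lb w)

-- Descending from a, a first x with ↓ L x ≢ ↓ La x would lie just below a switch point,
-- and ↓-≡-above-switch would then give ↓ La a ≡ ↓ Lb a.
↓-≡-below : (L La Lb : LinOrd n) → CoincideAtCommonBeginningSets La Lb →
  (∀ i → ↓ L i ≡ ↓ La i ⊎ ↓ L i ≡ ↓ Lb i) →
  ∀ {a} → ↓ L a ≡ ↓ La a → ↓ L a ≢ ↓ Lb a → ∀ {x} → rank L x ≤ rank L a → ↓ L x ≡ ↓ La x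
↓-≡-below L La Lb cond La-or-Lb {a} a-La a-¬Lb {x} x≤a =
  descend (rank L a ℕ.∸ rank L x) (ℕ.m∸n+n≡m x≤a)
  where
  descend : ∀ d {x} → d ℕ.+ rank L x ≡ rank L a → ↓ L x ≡ ↓ La x
  descend zero    x=a = subst (λ y → ↓ L y ≡ ↓ La y) (sym (rank-injective L x=a)) a-La
  descend (suc d) {x} d+1+x=a with ↓ L x ≟ₛ ↓ La x
  ... | yes x-La = x-La
  ... | no x-¬La with successor L (ℕ.≤-trans (s≤s (ℕ.m≤n+m (rank L x) d)) (ℕ.≤-reflexive d+1+x=a))
  ...   | w , w=x+1 = ⊥-elim (a-¬Lb (trans a-La
          (↓-≡-above-switch L La Lb cond w=x+1 (descend d d+w=a) x-Lb x-¬La a∈↑w)))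
    where
    d+w=a : d ℕ.+ rank L w ≡ rank L a
    d+w=a = trans (cong (d ℕ.+_) w=x+1) (trans (ℕ.+-suc d (rank L x)) d+1+x=a)
    x-Lb : ↓ L x ≡ ↓ Lb x
    x-Lb = [ ⊥-elim ∘ x-¬La , id ]′ (La-or-Lb x)
    a∈↑w : a ∈ ↑ L w
    a∈↑w = Equivalence.from (∈↑ L) (ℕ.≤-trans (ℕ.m≤n+m (rank L w) d) (ℕ.≤-reflexive d+w=a))

↓-follows-one : (L L₁ L₂ : LinOrd n) → CoincideAtCommonBeginningSets L₁ L₂ →
  (∀ i → ↓ L i ≡ ↓ L₁ i ⊎ ↓ L i ≡ ↓ L₂ i) → (∀ i → ↓ L i ≡ ↓ L₁ i) ⊎ (∀ i → ↓ L i ≡ ↓ L₂ i)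
↓-follows-one {n} L L₁ L₂ cond L₁-or-L₂ with Fin.all? (λ i → ↓ L i ≟ₛ ↓ L₁ i)
... | yes all-L₁ = inj₁ all-L₁
... | no ¬all-L₁ with Fin.¬∀⟶∃¬ n _ (λ i → ↓ L i ≟ₛ ↓ L₁ i) ¬all-L₁
...   | b , b-¬L₁ = inj₂ all-L₂
  where
  b-L₂ : ↓ L b ≡ ↓ L₂ b
  b-L₂ = [ ⊥-elim ∘ b-¬L₁ , id ]′ (L₁-or-L₂ b)
  all-L₂ : ∀ a → ↓ L a ≡ ↓ L₂ a
  all-L₂ a with ↓ L a ≟ₛ ↓ L₂ a
  ... | yes a-L₂ = a-L₂
  ... | no a-¬L₂ = [ ⊥-elim ∘ b-¬L₁ ∘ ↓-≡-below L L₁ L₂ cond L₁-or-L₂ a-L₁ a-¬L₂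
                   , ↓-≡-below L L₂ L₁ (CoincideAtCommonBeginningSets-sym L₁ L₂ cond)
                                  (Sum.swap ∘ L₁-or-L₂) b-L₂ b-¬L₁
                   ]′ (ℕ.≤-total (rank L b) (rank L a))
    where
    a-L₁ : ↓ L a ≡ ↓ L₁ a
    a-L₁ = [ id , ⊥-elim ∘ a-¬L₂ ]′ (L₁-or-L₂ a)

module _ (L₁ L₂ : LinOrd n) where

  Allowed : Fin n → Subset n → Set
  Allowed i T = T ≡ ↓ L₁ i ⊎ T ≡ ↓ L₂ i

  allowed? : ∀ i T → Dec (Allowed i T)
  allowed? i T = (T ≟ₛ ↓ L₁ i) ⊎-dec (T ≟ₛ ↓ L₂ i)

  penalty : Fin n → Subset n → ℚ
  penalty i T = - 𝟙 (i ∈? T ×-dec ¬? (allowed? i T))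

  penalty≤0 : ∀ i T → penalty i T ℚ.≤ 0ℚ
  penalty≤0 i T with i ∈? T ×-dec ¬? (allowed? i T)
  ... | yes _ = ℚ.*≤* ℤ.-≤+
  ... | no  _ = ℚ.≤-refl

  penalty-vanishes : ∀ i T → i ∉ T → penalty i T ≡ 0ℚ
  penalty-vanishes i T i∉T = cong -_ (𝟙-no _ (i∉T ∘ proj₁))

  penalty-allowed : ∀ i T → Allowed i T → penalty i T ≡ 0ℚ
  penalty-allowed i T allowed = cong -_ (𝟙-no _ (λ (_ , ¬allowed) → ¬allowed allowed))

  penalty-forbidden : ∀ i T → i ∈ T → ¬ Allowed i T → penalty i T ℚ.< 0ℚ
  penalty-forbidden i T i∈T ¬allowed =
    subst (ℚ._< 0ℚ) (sym (cong -_ (𝟙-yes _ (i∈T , ¬allowed)))) (ℚ.*<* ℤ.-<+)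

condition⇒adjacent : (L₁ L₂ : LinOrd n) → CoincideAtCommonBeginningSets L₁ L₂ → Adjacent L₁ L₂
condition⇒adjacent {n} L₁ L₂ cond = c , trans value₁ (sym value₂) , below
  where
  c : Vecᴱ n
  c = functional (penalty L₁ L₂)
  value : ∀ L → ⟪ c , p L ⟫ ≡ ∑[ i ← allFinL n ] penalty L₁ L₂ i (↓ L i)
  value = ⟪functional,p⟫ (penalty L₁ L₂) (penalty-vanishes L₁ L₂)
  value-allowed : ∀ L → (∀ i → Allowed L₁ L₂ i (↓ L i)) → ⟪ c , p L ⟫ ≡ 0ℚ
  value-allowed L allowed =
    trans (value L) (∑-zero (allFinL n) λ i → penalty-allowed L₁ L₂ i (↓ L i) (allowed i))
  value₁ : ⟪ c , p L₁ ⟫ ≡ 0ℚ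
  value₁ = value-allowed L₁ (λ _ → inj₁ refl)
  value₂ : ⟪ c , p L₂ ⟫ ≡ 0ℚ
  value₂ = value-allowed L₂ (λ _ → inj₂ refl)
  below : ∀ L → ¬ (p L ≡ᴱ p L₁) → ¬ (p L ≡ᴱ p L₂) → ⟪ c , p L ⟫ ℚ.< ⟪ c , p L₁ ⟫
  below L L≢L₁ L≢L₂ with Fin.¬∀⟶∃¬ n _ (λ i → allowed? L₁ L₂ i (↓ L i)) some-forbidden
    where
    some-forbidden : ¬ (∀ i → Allowed L₁ L₂ i (↓ L i))
    some-forbidden allowed = [ L≢L₁ ∘ ↓-≡⇒p-≡ᴱ L L₁ , L≢L₂ ∘ ↓-≡⇒p-≡ᴱ L L₂ ]′
                               (↓-follows-one L L₁ L₂ cond allowed)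
  ... | i , forbidden = subst₂ ℚ._<_ (sym (value L)) (sym value₁)
    (∑-negative (allFinL n) _ (λ i → penalty≤0 L₁ L₂ i (↓ L i)) (∈-allFin i)
                (penalty-forbidden L₁ L₂ i (↓ L i) (Equivalence.from (∈↓ L) ℕ.≤-refl) forbidden))

-- Necessity of the beginning-set condition

-- Pigeonhole: the t elements of B-rank below t all have A-rank below s.
rank-count : (A B : LinOrd n) {s t : ℕ} → t ≤ n → (∀ x → rank B x < t → rank A x < s) → t ≤ s
rank-count {n} A B {s} {t} t≤n below = ℕ.≮⇒≥ λ s<t →
  let i , j , i<j , fi≡fj = Fin.pigeonhole s<t f
  in ℕ.<-irrefl (trans (sym (rank-y i)) (trans (cong (rank B) (y-injective fi≡fj)) (rank-y j))) i<j
  where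
  y : Fin t → Fin n
  y k = unrank B (ℕ.<-≤-trans (Fin.toℕ<n k) t≤n)
  rank-y : ∀ k → rank B (y k) ≡ toℕ k
  rank-y k = rank-unrank B (ℕ.<-≤-trans (Fin.toℕ<n k) t≤n)
  f : Fin t → Fin s
  f k = fromℕ< (below (y k) (subst (_< t) (sym (rank-y k)) (Fin.toℕ<n k)))
  y-injective : ∀ {i j} → f i ≡ f j → y i ≡ y j
  y-injective fi≡fj = rank-injective A
    (trans (sym (Fin.toℕ-fromℕ< _)) (trans (cong toℕ fi≡fj) (Fin.toℕ-fromℕ< _)))

beginning-sets-same-threshold : (L₁ L₂ : LinOrd n) {S : Subset n} {a₁ a₂ : Fin n} →
  (∀ x → x ∈ S ⇔ rank L₁ a₁ ≤ rank L₁ x) → (∀ x → x ∈ S ⇔ rank L₂ a₂ ≤ rank L₂ x) →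
  rank L₁ a₁ ≡ rank L₂ a₂
beginning-sets-same-threshold {n} L₁ L₂ {S} S-L₁ S-L₂ =
  ℕ.≤-antisym (bound L₁ L₂ S-L₁ S-L₂) (bound L₂ L₁ S-L₂ S-L₁)
  where
  bound : (A B : LinOrd n) {a b : Fin n} → (∀ x → x ∈ S ⇔ rank A a ≤ rank A x) →
          (∀ x → x ∈ S ⇔ rank B b ≤ rank B x) → rank A a ≤ rank B b
  bound A B {a} S-A S-B = rank-count B A (ℕ.<⇒≤ (rank<n A a)) λ x x<a →
    ℕ.≰⇒> (ℕ.<⇒≱ x<a ∘ Equivalence.to (S-A x) ∘ Equivalence.from (S-B x))

module Splice (A B : LinOrd n) (S : Subset n) (t : ℕ)
              (S-A : ∀ x → x ∈ S ⇔ t ≤ rank A x) (S-B : ∀ x → x ∈ S ⇔ t ≤ rank B x) where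

  private
    to : Fin n → Fin n
    to x with x ∈? S
    ... | yes _ = A ⟨$⟩ʳ x
    ... | no  _ = B ⟨$⟩ʳ x

    from : Fin n → Fin n
    from k with t ≤? toℕ k
    ... | yes _ = A ⟨$⟩ˡ k
    ... | no  _ = B ⟨$⟩ˡ k

    to∘from : ∀ k → to (from k) ≡ k
    to∘from k with t ≤? toℕ k
    ... | yes t≤k with A ⟨$⟩ˡ k ∈? S
    ...   | yes _  = inverseʳ A
    ...   | no  ∉S = ⊥-elim (∉S (Equivalence.from (S-A _) (subst (t ≤_) (sym (cong toℕ (inverseʳ A))) t≤k)))
    to∘from k | no t≰k with B ⟨$⟩ˡ k ∈? S
    ...   | yes ∈S = ⊥-elim (t≰k (subst (t ≤_) (cong toℕ (inverseʳ B)) (Equivalence.to (S-B _) ∈S)))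
    ...   | no  _  = inverseʳ B

    from∘to : ∀ x → from (to x) ≡ x
    from∘to x with x ∈? S
    ... | yes x∈S with t ≤? rank A x
    ...   | yes _   = inverseˡ A
    ...   | no  t≰x = ⊥-elim (t≰x (Equivalence.to (S-A x) x∈S))
    from∘to x | no x∉S with t ≤? rank B x
    ...   | yes t≤x = ⊥-elim (x∉S (Equivalence.from (S-B x) t≤x))
    ...   | no  _   = inverseˡ B

  splice : LinOrd n
  splice = permutation to from to∘from from∘to

  private
    rank-∈ : ∀ {x} → x ∈ S → rank splice x ≡ rank A x
    rank-∈ {x} x∈S with x ∈? S
    ... | yes _   = refl
    ... | no  x∉S = ⊥-elim (x∉S x∈S)

    rank-∉ : ∀ {x} → x ∉ S → rank splice x ≡ rank B x
    rank-∉ {x} x∉S with x ∈? S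
    ... | yes x∈S = ⊥-elim (x∉S x∈S)
    ... | no  _   = refl

    S-above : (L : LinOrd n) → (∀ x → x ∈ S ⇔ t ≤ rank L x) → ∀ {x y} → x ∉ S → y ∈ S → rank L x < rank L y
    S-above L S-L x∉S y∈S = ℕ.<-≤-trans (ℕ.≰⇒> (x∉S ∘ Equivalence.from (S-L _))) (Equivalence.to (S-L _) y∈S)

    S-above-splice : ∀ {x y} → x ∉ S → y ∈ S → rank splice x < rank splice y
    S-above-splice {x} {y} x∉S y∈S = subst₂ _<_ (sym (rank-∉ x∉S)) (sym (rank-∈ y∈S))
      (ℕ.<-≤-trans (ℕ.≰⇒> (x∉S ∘ Equivalence.from (S-B x))) (Equivalence.to (S-A y) y∈S))

  agrees-∈ : ∀ {i} → i ∈ S → ∀ j → i >[ splice ] j ⇔ i >[ A ] j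
  agrees-∈ i∈S j = case j ∈? S of λ where
    (yes j∈S) → mk⇔ (subst₂ _<_ (rank-∈ j∈S) (rank-∈ i∈S)) (subst₂ _<_ (sym (rank-∈ j∈S)) (sym (rank-∈ i∈S)))
    (no  j∉S) → mk⇔ (λ _ → S-above A S-A j∉S i∈S) (λ _ → S-above-splice j∉S i∈S)

  agrees-∉ : ∀ {i} → i ∉ S → ∀ j → i >[ splice ] j ⇔ i >[ B ] j
  agrees-∉ i∉S j = case j ∈? S of λ where
    (yes j∈S) → mk⇔ (⊥-elim ∘ ℕ.<-asym (S-above-splice i∉S j∈S)) (⊥-elim ∘ ℕ.<-asym (S-above B S-B i∉S j∈S))
    (no  j∉S) → mk⇔ (subst₂ _<_ (rank-∉ j∉S) (rank-∉ i∉S)) (subst₂ _<_ (sym (rank-∉ j∉S)) (sym (rank-∉ i∉S)))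

p-cong : (M L : LinOrd n) {i : Fin n} → (∀ j → i >[ M ] j ⇔ i >[ L ] j) → ∀ T → p M i T ≡ p L i T
p-cong M L {i} M~L T = 𝟙-cong (mk⇔ (λ top j j∈T j≢i → Equivalence.to (M~L j) (top j j∈T j≢i))
                                   (λ top j j∈T j≢i → Equivalence.from (M~L j) (top j j∈T j≢i)))
                              (isTop? M i T) (isTop? L i T)

-- p L i ⁅ i , j ⁆ records whether i >_L j.
p-≡ᴱ⇒> : (L L′ : LinOrd n) → p L ≡ᴱ p L′ → ∀ {i j} → i >[ L ] j → i >[ L′ ] j
p-≡ᴱ⇒> {n} L L′ pL≡pL′ {i} {j} i>j = top′ j (x∈p∪q⁺ (inj₂ (x∈⁅x⁆ j))) j≢i
  where
  T : Subset n
  T = ⁅ i ⁆ ∪ ⁅ j ⁆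
  j≢i : j ≢ i
  j≢i refl = ℕ.<-irrefl refl i>j
  top : IsTop L i T
  top k k∈T k≢i = [ ⊥-elim ∘ k≢i ∘ x∈⁅y⁆⇒x≡y i
                  , (λ k∈⁅j⁆ → subst (λ k → i >[ L ] k) (sym (x∈⁅y⁆⇒x≡y j k∈⁅j⁆)) i>j)
                  ]′ (x∈p∪q⁻ ⁅ i ⁆ ⁅ j ⁆ k∈T)
  top′ : IsTop L′ i T
  top′ = 𝟙≡1⇒ (isTop? L′ i T) (trans (sym (pL≡pL′ i T (x∈p∪q⁺ (inj₁ (x∈⁅x⁆ i))))) (𝟙-yes (isTop? L i T) top))

CoincideOn-of-p-≡ᴱ : (M A B : LinOrd n) {U : Subset n} →
                     (∀ {i} → i ∈ U → ∀ j → i >[ M ] j ⇔ i >[ A ] j) → p M ≡ᴱ p B → CoincideOn A B U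
CoincideOn-of-p-≡ᴱ M A B M~A pM≡pB i j i∈U _ =
  mk⇔ (p-≡ᴱ⇒> M B pM≡pB) (p-≡ᴱ⇒> B M (λ k T k∈T → sym (pM≡pB k T k∈T))) ⇔-∘ ⇔-sym (M~A i∈U j)

differ-on-both-sides⇒¬Adjacent : (L₁ L₂ : LinOrd n) {S : Subset n} →
  IsBeginningSet L₁ S → IsBeginningSet L₂ S → ¬ CoincideOn L₁ L₂ S → ¬ CoincideOn L₁ L₂ (∁ S) →
  ¬ Adjacent L₁ L₂
differ-on-both-sides⇒¬Adjacent {n} L₁ L₂ {S} (a₁ , S-L₁) (a₂ , S-L₂) ¬coS ¬co∁S (c , c₁≡c₂ , below) =
  ℚ.<-irrefl sums-equal sums-less
  where
  S-L₂′ : ∀ x → x ∈ S ⇔ rank L₁ a₁ ≤ rank L₂ x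
  S-L₂′ x = subst (λ t → x ∈ S ⇔ t ≤ rank L₂ x) (sym (beginning-sets-same-threshold L₁ L₂ S-L₁ S-L₂)) (S-L₂ x)
  module M₃ = Splice L₁ L₂ S (rank L₁ a₁) S-L₁ S-L₂′
  module M₄ = Splice L₂ L₁ S (rank L₁ a₁) S-L₂′ S-L₁
  L₃ L₄ : LinOrd n
  L₃ = M₃.splice
  L₄ = M₄.splice
  vertex-sum : ∀ {i} → Dec (i ∈ S) → ∀ T → p L₃ i T + p L₄ i T ≡ p L₁ i T + p L₂ i T
  vertex-sum (yes i∈S) T = cong₂ _+_ (p-cong L₃ L₁ (M₃.agrees-∈ i∈S) T) (p-cong L₄ L₂ (M₄.agrees-∈ i∈S) T)
  vertex-sum {i} (no i∉S) T =
    trans (cong₂ _+_ (p-cong L₃ L₂ (M₃.agrees-∉ i∉S) T) (p-cong L₄ L₁ (M₄.agrees-∉ i∉S) T))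
          (ℚ.+-comm (p L₂ i T) (p L₁ i T))
  L₃≢L₁ : ¬ (p L₃ ≡ᴱ p L₁)
  L₃≢L₁ = ¬co∁S ∘ CoincideOn-sym L₂ L₁ ∘ CoincideOn-of-p-≡ᴱ L₃ L₂ L₁ (M₃.agrees-∉ ∘ x∈∁p⇒x∉p)
  L₃≢L₂ : ¬ (p L₃ ≡ᴱ p L₂)
  L₃≢L₂ = ¬coS ∘ CoincideOn-of-p-≡ᴱ L₃ L₁ L₂ M₃.agrees-∈
  L₄≢L₁ : ¬ (p L₄ ≡ᴱ p L₁)
  L₄≢L₁ = ¬coS ∘ CoincideOn-sym L₂ L₁ ∘ CoincideOn-of-p-≡ᴱ L₄ L₂ L₁ M₄.agrees-∈
  L₄≢L₂ : ¬ (p L₄ ≡ᴱ p L₂)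
  L₄≢L₂ = ¬co∁S ∘ CoincideOn-of-p-≡ᴱ L₄ L₁ L₂ (M₄.agrees-∉ ∘ x∈∁p⇒x∉p)
  sums-equal : ⟪ c , p L₃ ⟫ + ⟪ c , p L₄ ⟫ ≡ ⟪ c , p L₁ ⟫ + ⟪ c , p L₂ ⟫
  sums-equal = trans (⟪⟫-+ c (p L₃) (p L₄))
    (trans (⟪⟫-cong c (λ i T _ → vertex-sum (i ∈? S) T)) (sym (⟪⟫-+ c (p L₁) (p L₂))))
  sums-less : ⟪ c , p L₃ ⟫ + ⟪ c , p L₄ ⟫ ℚ.< ⟪ c , p L₁ ⟫ + ⟪ c , p L₂ ⟫
  sums-less = ℚ.+-mono-< (below L₃ L₃≢L₁ L₃≢L₂) (subst (ℚ._<_ _) c₁≡c₂ (below L₄ L₄≢L₁ L₄≢L₂))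

coincideOn? : (L₁ L₂ : LinOrd n) (S : Subset n) → Dec (CoincideOn L₁ L₂ S)
coincideOn? L₁ L₂ S = Fin.all? λ i → Fin.all? λ j →
  i ∈? S →-dec (j ∈? S →-dec ⇔? (L₁ ⟨$⟩ʳ j Fin.<? L₁ ⟨$⟩ʳ i) (L₂ ⟨$⟩ʳ j Fin.<? L₂ ⟨$⟩ʳ i))
  where
  ⇔? : Dec P → Dec Q → Dec (P ⇔ Q)
  ⇔? P? Q? = Dec.map′ (λ (f , g) → mk⇔ f g) (λ e → Equivalence.to e , Equivalence.from e)
                      ((P? →-dec Q?) ×-dec (Q? →-dec P?))

adjacent⇒condition : (L₁ L₂ : LinOrd n) → Adjacent L₁ L₂ → CoincideAtCommonBeginningSets L₁ L₂
adjacent⇒condition L₁ L₂ adj S _ _ S-L₁ S-L₂ with coincideOn? L₁ L₂ S | coincideOn? L₁ L₂ (∁ S)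
... | yes coS | _        = inj₁ coS
... | no  _   | yes co∁S = inj₂ co∁S
... | no ¬coS | no ¬co∁S = ⊥-elim (differ-on-both-sides⇒¬Adjacent L₁ L₂ S-L₁ S-L₂ ¬coS ¬co∁S adj)

proposition5 : (n : ℕ) (L₁ L₂ : LinOrd n) →
    ¬ (∀ (S : Subset n) → CoincideOn L₁ L₂ S) →
    (Adjacent L₁ L₂ ⇔
      (∀ (S : Subset n) → Nonempty S → Proper S →
        IsBeginningSet L₁ S → IsBeginningSet L₂ S →
        (CoincideOn L₁ L₂ S ⊎ CoincideOn L₁ L₂ (∁ S))))
proposition5 n L₁ L₂ _ = mk⇔ (adjacent⇒condition L₁ L₂) (condition⇒adjacent L₁ L₂)
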